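{- For every integer $n \geq 2$ and every $n$-vertex graph $G$, there exists a graph $G'$ with fewer than $n^2$ vertices whose sd-degeneracy is at most $1$ and which contains $G$ as an induced subgraph.
   Context: All graphs are finite and simple. For distinct vertices $u,v$ of a graph $G$, let $\mathrm{sd}_G(u,v) := |(N_G(u)\setminus\{v\}) \triangle (N_G(v)\setminus\{u\})|$, where $N_G(x)$ is the open neighborhood and $\triangle$ is symmetric difference. The sd-degeneracy $\mathrm{sdd}(G)$ of $G$ is the smallest nonnegative integer $d$ such that either $|V(G)|=1$, or there are distinct $u,v\in V(G)$ with $\mathrm{sd}_G(u,v)\le d$ and $\mathrm{sdd}(G-v)\le d$. Equivalently, $\mathrm{sdd}(G)\le d$ iff there is an ordering $v_1,\dots,v_n$ of $V(G)$ such that for every $i\in[n-1]$ there is $j>i$ with $\mathrm{sd}_{G-\{v_1,\dots,v_{i-1}\}}(v_i,v_j)\le d$. -}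

module Defs where

open import Data.Nat using (ℕ; zero; suc; _≤_)
open import Data.Bool using (Bool; true; false; _xor_; _∧_; not)
open import Data.Fin using (Fin; punchIn; _≟_)
open import Data.List using (List; filter; length)
open import Data.List using (allFin) public
open import Relation.Nullary using (¬_; Dec; yes; no; does)
open import Relation.Binary.PropositionalEquality using (_≡_; _≢_)
open import Function.Definitions using (Injective)
open import Data.Product using (Σ; _×_)

record Graph (n : ℕ) : Set where
  field
    adj    : Fin n → Fin n → Bool
    sym    : ∀ i j → adj i j ≡ adj j i
    irrefl : ∀ i → adj i i ≡ false
open Graph public

delete : ∀ {n} → Fin (suc n) → Graph (suc n) → Graph n
delete v G = record
  { adj    = λ i j → adj G (punchIn v i) (punchIn v j)
  ; sym    = λ i j → sym G (punchIn v i) (punchIn v j)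
  ; irrefl = λ i → irrefl G (punchIn v i)
  }

notIn2 : ∀ {n} → Fin n → Fin n → Fin n → Bool
notIn2 u v w = not (does (w ≟ u)) ∧ not (does (w ≟ v))

-- sd_G(u,v) = |(N(u) \ {v}) △ (N(v) \ {u})|.
-- Since u ∉ N(u) and v ∉ N(v), this is the number of vertices w ∉ {u,v}
-- adjacent to exactly one of u, v.
sd : ∀ {n} → Graph n → Fin n → Fin n → ℕ
sd G u v = length (filter (λ w → notIn2 u v w ∧ (adj G u w xor adj G v w) Data.Bool.≟ true) (allFin _))

data SddLe (d : ℕ) : ∀ {n} → Graph n → Set where
  single : (G : Graph 1) → SddLe d G
  step   : ∀ {n} (G : Graph (suc (suc n))) (u v : Fin (suc (suc n))) →
           u ≢ v → sd G u v ≤ d → SddLe d (delete v G) → SddLe d G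

InducedSub : ∀ {n m} → Graph n → Graph m → Set
InducedSub {n} {m} G H =
  Σ (Fin n → Fin m) λ f → Injective _≡_ _≡_ f × (∀ i j → adj H (f i) (f j) ≡ adj G i j)

-- Induct on n, keeping an isolated vertex in the model.  Given a model H of G − 0, with
-- S the neighbourhood of vertex 0 in G − 0, add pairwise non-adjacent vertices
-- c₀, c₁, …, cₙ, where cₜ is adjacent exactly to the images of the vertices i < t of S.
-- Then c₀ is a twin of the isolated vertex of H, consecutive cₜ are twins up to one
-- vertex, and deleting cₙ, …, c₀ in turn witnesses sd-degeneracy at most 1.  The last
-- vertex cₙ realises vertex 0 of G and c₀ is the isolated vertex of the new model, so a
-- graph on N vertices gets a model on N(N+1)/2 < N² vertices.
module Submission where

open import Defs
open import Data.Nat using (ℕ; zero; suc; _+_; _*_; _≤_; _<_; _<ᵇ_; z≤n; s≤s)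
open import Data.Product using (Σ; _×_; _,_)

open import Data.Bool using (Bool; true; false; _xor_; _∧_)
import Data.Bool as Bool
open import Data.Bool.Properties using (∧-conicalˡ; ∧-conicalʳ; ∧-distribʳ-xor; xor-same; T-≡)
open import Data.Fin using (Fin; zero; suc; toℕ; fromℕ; _↑ˡ_; _↑ʳ_; splitAt)
open import Data.Fin.Properties
  using (0≢1+n; suc-injective; toℕ-injective; toℕ<n; splitAt-↑ʳ; splitAt⁻¹-↑ʳ)
open import Data.List using (filter; length; tabulate)
open import Data.List.Properties using (filter-none)
open import Data.List.Relation.Unary.All.Properties using (tabulate⁺)
open import Data.Maybe using (Maybe; just; nothing; maybe)
import Data.Maybe as Maybe
open import Data.Maybe.Properties using (just-injective)
open import Data.Nat.Properties
  using (≤-reflexive; ≤-trans; ≤-<-trans; n≤1+n; n<1+n; +-monoʳ-≤; +-monoʳ-<; *-monoʳ-≤; *-monoʳ-<; <⇒<ᵇ)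
open import Data.Sum using ([_,_]; inj₂)
open import Function using (_∘_; const)
open import Function.Bundles using (Equivalence)
open import Function.Definitions using (Injective)
open import Relation.Binary.PropositionalEquality as ≡
  using (_≡_; refl; trans; cong; subst; _≗_; module ≡-Reasoning)

DifferAtMostOnce : ∀ {n} → (Fin n → Bool) → (Fin n → Bool) → Set
DifferAtMostOnce f g = ∀ x y → f x xor g x ≡ true → f y xor g y ≡ true → x ≡ y

≗⇒DifferAtMostOnce : ∀ {n} {f g : Fin n → Bool} → f ≗ g → DifferAtMostOnce f g
≗⇒DifferAtMostOnce {g = g} f≗g x y p _
  with () ← trans (≡.sym (xor-same (g x))) (subst (λ b → b xor g x ≡ true) (f≗g x) p)

DifferAtMostOnce-respˡ : ∀ {n} {f f′ g : Fin n → Bool} →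
  f ≗ f′ → DifferAtMostOnce f g → DifferAtMostOnce f′ g
DifferAtMostOnce-respˡ {g = g} f≗f′ d x y p q =
  d x y (subst (λ b → b xor g x ≡ true) (≡.sym (f≗f′ x)) p)
        (subst (λ b → b xor g y ≡ true) (≡.sym (f≗f′ y)) q)

length-filter-tabulate-≤1 : ∀ {A : Set} (P : A → Bool) {k} (f : Fin k → A) →
  (∀ i j → P (f i) ≡ true → P (f j) ≡ true → i ≡ j) →
  length (filter (λ a → P a Bool.≟ true) (tabulate f)) ≤ 1
length-filter-tabulate-≤1 P {zero}  f unique = z≤n
length-filter-tabulate-≤1 P {suc k} f unique with P (f zero) in eq
... | true  = s≤s (≤-reflexive (cong length (filter-none (λ a → P a Bool.≟ true)
                (tabulate⁺ λ i eq′ → 0≢1+n (unique zero (suc i) eq eq′)))))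
... | false = length-filter-tabulate-≤1 P (f ∘ suc)
                (λ i j p q → suc-injective (unique (suc i) (suc j) p q))

sd-≤1 : ∀ {n} (G : Graph n) u v → DifferAtMostOnce (adj G u) (adj G v) → sd G u v ≤ 1
sd-≤1 G u v differ =
  length-filter-tabulate-≤1 (λ w → notIn2 u v w ∧ (adj G u w xor adj G v w)) (λ w → w)
    λ x y p q → differ x y (∧-conicalʳ _ _ p) (∧-conicalʳ _ _ q)

addVertex : ∀ {n} → Graph n → (Fin n → Bool) → Graph (suc n)
addVertex {n} H N = record { adj = a ; sym = a-sym ; irrefl = a-irrefl }
  where
    a : Fin (suc n) → Fin (suc n) → Bool
    a zero    zero    = false
    a zero    (suc y) = N y
    a (suc x) zero    = N x
    a (suc x) (suc y) = adj H x y
    a-sym : ∀ x y → a x y ≡ a y x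
    a-sym zero    zero    = refl
    a-sym zero    (suc y) = refl
    a-sym (suc x) zero    = refl
    a-sym (suc x) (suc y) = sym H x y
    a-irrefl : ∀ x → a x x ≡ false
    a-irrefl zero    = refl
    a-irrefl (suc x) = irrefl H x

-- delete zero (addVertex H N) reduces to H, so sddH is exactly the required tail.
addVertex-sdd : ∀ {n} {H : Graph (suc n)} {N : Fin (suc n) → Bool} (u : Fin (suc n)) →
  N u ≡ false → DifferAtMostOnce (adj H u) N → SddLe 1 H → SddLe 1 (addVertex H N)
addVertex-sdd {H = H} {N} u Nu≡false differ sddH =
  step (addVertex H N) (suc u) zero (λ ()) (sd-≤1 (addVertex H N) (suc u) zero twins) sddH
  where
    twins : DifferAtMostOnce (adj (addVertex H N) (suc u)) (adj (addVertex H N) zero)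
    twins zero    zero    _ _ = refl
    twins zero    (suc y) p _ with () ← subst (λ b → b xor false ≡ true) Nu≡false p
    twins (suc x) zero    _ q with () ← subst (λ b → b xor false ≡ true) Nu≡false q
    twins (suc x) (suc y) p q = cong suc (differ x y p q)

padFalse : ∀ k {n} → (Fin n → Bool) → Fin (k + n) → Bool
padFalse zero    N x       = N x
padFalse (suc k) N zero    = false
padFalse (suc k) N (suc x) = padFalse k N x

padFalse-↑ʳ : ∀ k {n} (N : Fin n → Bool) x → padFalse k N (k ↑ʳ x) ≡ N x
padFalse-↑ʳ zero    N x = refl
padFalse-↑ʳ (suc k) N x = padFalse-↑ʳ k N x

padFalse-↑ˡ : ∀ {k} n (N : Fin n → Bool) (i : Fin k) → padFalse k N (i ↑ˡ n) ≡ false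
padFalse-↑ˡ {suc k} n N zero    = refl
padFalse-↑ˡ {suc k} n N (suc i) = padFalse-↑ˡ n N i

padFalse-differ : ∀ k {n} {M N : Fin n → Bool} →
  DifferAtMostOnce M N → DifferAtMostOnce (padFalse k M) (padFalse k N)
padFalse-differ zero    d = d
padFalse-differ (suc k) d zero    zero    p q = refl
padFalse-differ (suc k) d (suc x) (suc y) p q = cong suc (padFalse-differ k d x y p q)

module Chain {m} (H : Graph (suc m)) (N : ℕ → Fin (suc m) → Bool) where

  chain : ∀ t → Graph (suc (t + suc m))
  chain zero    = addVertex H (N 0)
  chain (suc t) = addVertex (chain t) (padFalse (suc t) (N (suc t)))

  chain-tip-adj : ∀ t → adj (chain t) zero ≗ padFalse (suc t) (N t)
  chain-tip-adj zero    zero    = refl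
  chain-tip-adj zero    (suc x) = refl
  chain-tip-adj (suc t) zero    = refl
  chain-tip-adj (suc t) (suc x) = refl

  chain-tip-adj-↑ʳ : ∀ t x → adj (chain t) zero (suc t ↑ʳ x) ≡ N t x
  chain-tip-adj-↑ʳ t x = trans (chain-tip-adj t (suc t ↑ʳ x)) (padFalse-↑ʳ (suc t) (N t) x)

  chain-adj-↑ʳ : ∀ t x y → adj (chain t) (suc t ↑ʳ x) (suc t ↑ʳ y) ≡ adj H x y
  chain-adj-↑ʳ zero    x y = refl
  chain-adj-↑ʳ (suc t) x y = chain-adj-↑ʳ t x y

  chain-first-isolated : (∀ x → N 0 x ≡ false) → ∀ t x → adj (chain t) (fromℕ t ↑ˡ suc m) x ≡ false
  chain-first-isolated N₀≡false zero    zero    = refl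
  chain-first-isolated N₀≡false zero    (suc x) = N₀≡false x
  chain-first-isolated N₀≡false (suc t) zero    = padFalse-↑ˡ (suc m) (N (suc t)) (fromℕ t)
  chain-first-isolated N₀≡false (suc t) (suc x) = chain-first-isolated N₀≡false t x

  chain-sdd : SddLe 1 H → (o : Fin (suc m)) → N 0 o ≡ false → DifferAtMostOnce (adj H o) (N 0) →
              (∀ t → DifferAtMostOnce (N t) (N (suc t))) → ∀ t → SddLe 1 (chain t)
  chain-sdd sddH o N₀o≡false start steps zero    = addVertex-sdd o N₀o≡false start sddH
  chain-sdd sddH o N₀o≡false start steps (suc t) =
    addVertex-sdd zero refl
      (DifferAtMostOnce-respˡ (≡.sym ∘ chain-tip-adj t) (padFalse-differ (suc t) (steps t)))
      (chain-sdd sddH o N₀o≡false start steps t)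

<ᵇ-xor-<ᵇ-suc : ∀ m t → (m <ᵇ t) xor (m <ᵇ suc t) ≡ true → m ≡ t
<ᵇ-xor-<ᵇ-suc zero    zero    _ = refl
<ᵇ-xor-<ᵇ-suc (suc m) (suc t) p = cong suc (<ᵇ-xor-<ᵇ-suc m t p)

prefix : ∀ {n} → ℕ → (Fin n → Bool) → Fin n → Bool
prefix t S i = (toℕ i <ᵇ t) ∧ S i

prefix-differ : ∀ {n} (S : Fin n → Bool) t → DifferAtMostOnce (prefix t S) (prefix (suc t) S)
prefix-differ S t i j p q = toℕ-injective (trans (flipped i p) (≡.sym (flipped j q)))
  where
    flipped : ∀ i → prefix t S i xor prefix (suc t) S i ≡ true → toℕ i ≡ t
    flipped i p = <ᵇ-xor-<ᵇ-suc (toℕ i) t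
      (∧-conicalˡ _ (S i) (trans (∧-distribʳ-xor (S i) (toℕ i <ᵇ t) (toℕ i <ᵇ suc t)) p))

prefix-full : ∀ {n} (S : Fin n → Bool) → prefix n S ≗ S
prefix-full S i = cong (_∧ S i) (Equivalence.to T-≡ (<⇒<ᵇ (toℕ<n i)))

-- The subset S of Fin n, carried to Fin k along the partial inverse π of an embedding.
pushforward : ∀ {n k} → (Fin k → Maybe (Fin n)) → (Fin n → Bool) → Fin k → Bool
pushforward π S x = maybe S false (π x)

pushforward-empty : ∀ {n k} (π : Fin k → Maybe (Fin n)) → pushforward π (const false) ≗ const false
pushforward-empty π x with π x
... | just _  = refl
... | nothing = refl

pushforward-differ : ∀ {n k} {π : Fin k → Maybe (Fin n)} {S T : Fin n → Bool} →
  (∀ {x y i} → π x ≡ just i → π y ≡ just i → x ≡ y) →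
  DifferAtMostOnce S T → DifferAtMostOnce (pushforward π S) (pushforward π T)
pushforward-differ {π = π} π-injective d x y p q with π x in πx | π y in πy
... | just i | just j = π-injective πx (subst (λ z → π y ≡ just z) (≡.sym (d i j p q)) πy)

triangle : ℕ → ℕ
triangle zero    = zero
triangle (suc n) = suc n + triangle n

triangle-≤ : ∀ n → triangle n ≤ n * n
triangle-≤ zero    = z≤n
triangle-≤ (suc n) = +-monoʳ-≤ (suc n) (≤-trans (triangle-≤ n) (*-monoʳ-≤ n (n≤1+n n)))

triangle-< : ∀ {n} → 2 ≤ n → triangle n < n * n
triangle-< {suc (suc n)} (s≤s (s≤s _)) =
  +-monoʳ-< (suc (suc n)) (≤-<-trans (triangle-≤ (suc n)) (*-monoʳ-< (suc n) (n<1+n (suc n))))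

record Model {n} (G : Graph (suc n)) : Set where
  field
    graph          : Graph (triangle (suc n))
    sdd≤1          : SddLe 1 graph
    embed          : Fin (suc n) → Fin (triangle (suc n))
    embed-adj      : ∀ i j → adj graph (embed i) (embed j) ≡ adj G i j
    preimage       : Fin (triangle (suc n)) → Maybe (Fin (suc n))
    preimage-embed : ∀ i → preimage (embed i) ≡ just i
    embed-preimage : ∀ {x i} → preimage x ≡ just i → embed i ≡ x
    isolated       : Fin (triangle (suc n))
    isolated-adj   : ∀ x → adj graph isolated x ≡ false

  embed-injective : Injective _≡_ _≡_ embed
  embed-injective {i} {j} e =
    just-injective (trans (≡.sym (preimage-embed i)) (trans (cong preimage e) (preimage-embed j)))

  preimage-injective : ∀ {x y i} → preimage x ≡ just i → preimage y ≡ just i → x ≡ y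
  preimage-injective p q = trans (≡.sym (embed-preimage p)) (embed-preimage q)

edgeless : ∀ n → Graph n
edgeless n = record { adj = λ _ _ → false ; sym = λ _ _ → refl ; irrefl = λ _ → refl }

model-single : (G : Graph 1) → Model G
model-single G = record
  { graph          = edgeless 1
  ; sdd≤1          = single (edgeless 1)
  ; embed          = λ i → i
  ; embed-adj      = λ { zero zero → ≡.sym (irrefl G zero) }
  ; preimage       = just
  ; preimage-embed = λ _ → refl
  ; embed-preimage = λ { refl → refl }
  ; isolated       = zero
  ; isolated-adj   = λ _ → refl
  }

module Extension {n} (G : Graph (suc (suc n))) (R : Model (delete zero G)) where
  open Model R

  neighbours : Fin (suc n) → Bool
  neighbours i = adj G zero (suc i)

  open Chain graph (λ t → pushforward preimage (prefix t neighbours))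

  embed′ : Fin (suc (suc n)) → Fin (triangle (suc (suc n)))
  embed′ zero    = zero
  embed′ (suc i) = suc (suc n) ↑ʳ embed i

  embed′-adj-zero : ∀ j → adj (chain (suc n)) zero (embed′ (suc j)) ≡ adj G zero (suc j)
  embed′-adj-zero j = begin
    adj (chain (suc n)) zero (suc (suc n) ↑ʳ embed j)                ≡⟨ chain-tip-adj-↑ʳ (suc n) (embed j) ⟩
    pushforward preimage (prefix (suc n) neighbours) (embed j)        ≡⟨ cong (maybe _ false) (preimage-embed j) ⟩
    prefix (suc n) neighbours j                                       ≡⟨ prefix-full neighbours j ⟩
    adj G zero (suc j)                                                ∎
    where open ≡-Reasoning

  embed′-adj : ∀ i j → adj (chain (suc n)) (embed′ i) (embed′ j) ≡ adj G i j
  embed′-adj zero    zero    = ≡.sym (irrefl G zero)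
  embed′-adj zero    (suc j) = embed′-adj-zero j
  embed′-adj (suc i) zero    =
    trans (sym (chain (suc n)) (embed′ (suc i)) zero) (trans (embed′-adj-zero i) (sym G zero (suc i)))
  embed′-adj (suc i) (suc j) = trans (chain-adj-↑ʳ (suc n) (embed i) (embed j)) (embed-adj i j)

  -- Position 0 holds the last chain vertex; the other chain vertices occupy
  -- positions 1, …, n + 1 and have no preimage.
  preimage′ : Fin (triangle (suc (suc n))) → Maybe (Fin (suc (suc n)))
  preimage′ zero    = just zero
  preimage′ (suc x) = [ const nothing , Maybe.map suc ∘ preimage ] (splitAt (suc n) x)

  preimage′-embed′ : ∀ i → preimage′ (embed′ i) ≡ just i
  preimage′-embed′ zero    = refl
  preimage′-embed′ (suc i) = begin
    [ const nothing , Maybe.map suc ∘ preimage ] (splitAt (suc n) (suc n ↑ʳ embed i))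
      ≡⟨ cong [ const nothing , Maybe.map suc ∘ preimage ] (splitAt-↑ʳ (suc n) _ (embed i)) ⟩
    Maybe.map suc (preimage (embed i))
      ≡⟨ cong (Maybe.map suc) (preimage-embed i) ⟩
    just (suc i)
      ∎
    where open ≡-Reasoning

  embed′-preimage′ : ∀ {x i} → preimage′ x ≡ just i → embed′ i ≡ x
  embed′-preimage′ {zero}  refl = refl
  embed′-preimage′ {suc x} p with splitAt (suc n) x in split
  ... | inj₂ y with preimage y in py
  embed′-preimage′ {suc x} refl | inj₂ y | just k =
    cong suc (trans (cong (suc n ↑ʳ_) (embed-preimage py)) (splitAt⁻¹-↑ʳ split))

  model : Model G
  model = record
    { graph          = chain (suc n)
    ; sdd≤1          = chain-sdd sdd≤1 isolated (pushforward-empty preimage isolated)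
                         (≗⇒DifferAtMostOnce λ x → trans (isolated-adj x) (≡.sym (pushforward-empty preimage x)))
                         (λ t → pushforward-differ preimage-injective (prefix-differ neighbours t))
                         (suc n)
    ; embed          = embed′
    ; embed-adj      = embed′-adj
    ; preimage       = preimage′
    ; preimage-embed = preimage′-embed′
    ; embed-preimage = embed′-preimage′
    ; isolated       = fromℕ (suc n) ↑ˡ triangle (suc n)
    ; isolated-adj   = chain-first-isolated (pushforward-empty preimage) (suc n)
    }

model : ∀ n (G : Graph (suc n)) → Model G
model zero    G = model-single G
model (suc n) G = Extension.model G (model n (delete zero G))

proposition1p1 : (n : ℕ) → 2 ≤ n → (G : Graph n) →
    Σ ℕ λ m → m < n * n × Σ (Graph m) λ G' → SddLe 1 G' × InducedSub G G'
proposition1p1 (suc n) 2≤n G =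
  triangle (suc n) , triangle-< 2≤n , graph , sdd≤1 , embed , embed-injective , embed-adj
  where open Model (model n G)
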